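{- Let $G$ be a finite, simple, connected graph. If $G$ is uniquely dimensional, then $G$ contains no twin vertices.
   Context: For vertices $u,v$ of a connected graph $G$, $d(u,v)$ denotes the length of a shortest $u$–$v$ path. For an ordered set $W=\{w_1,\dots,w_k\}\subseteq V(G)$ and $v\in V(G)$, the metric representation is $r(v|W)=(d(v,w_1),\dots,d(v,w_k))$. $W$ is a resolving set if distinct vertices have distinct metric representations with respect to $W$. A resolving set of minimum cardinality is a metric basis, and its cardinality is the metric dimension $\beta(G)$. $G$ is uniquely dimensional if it has exactly one metric basis. Two distinct vertices $u,v$ are twin vertices if $N(u)\setminus\{v\}=N(v)\setminus\{u\}$, where $N(x)$ is the set of neighbours of $x$. -}

module Defs where

open import Data.Nat using (ℕ; zero; suc; _≤_)
open import Data.Fin using (Fin)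
open import Data.Fin.Subset using (Subset; _∈_; ∣_∣)
open import Data.Product using (Σ; _×_; ∃)
open import Relation.Binary.PropositionalEquality using (_≡_; _≢_)
open import Relation.Nullary using (¬_)

record Graph (n : ℕ) : Set₁ where
  field
    Adj     : Fin n → Fin n → Set
    sym     : ∀ {u v} → Adj u v → Adj v u
    irrefl  : ∀ {u} → ¬ Adj u u

module _ {n : ℕ} (G : Graph n) where
  open Graph G

  data Walk : Fin n → Fin n → ℕ → Set where
    [] : ∀ {u} → Walk u u zero
    _∷_ : ∀ {u w v k} → Adj u w → Walk w v k → Walk u v (suc k)

  Connected : Set
  Connected = ∀ u v → ∃ λ k → Walk u v k

  Dist : Fin n → Fin n → ℕ → Set
  Dist u v k = Walk u v k × (∀ j → Walk u v j → k ≤ j)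

  SameRep : Subset n → Fin n → Fin n → Set
  SameRep W u v = ∀ w → w ∈ W → ∀ k → (Dist u w k → Dist v w k) × (Dist v w k → Dist u w k)

  Resolving : Subset n → Set
  Resolving W = ∀ u v → SameRep W u v → u ≡ v

  MetricBasis : Subset n → Set
  MetricBasis W = Resolving W × (∀ W′ → Resolving W′ → ∣ W ∣ ≤ ∣ W′ ∣)

  UniquelyDimensional : Set
  UniquelyDimensional =
    Σ (Subset n) λ W → MetricBasis W × (∀ W′ → MetricBasis W′ → W′ ≡ W)

  Twins : Fin n → Fin n → Set
  Twins u v = u ≢ v ×
    (∀ x → x ≢ u → x ≢ v → (Adj u x → Adj v x) × (Adj v x → Adj u x))

-- If u and v are twins, the transposition of u and v is an automorphism of G, so it maps resolving
-- sets to resolving sets, and every resolving set contains u or v (otherwise u and v have the same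
-- representation).  Exchanging u for v in the unique basis W would give another basis, so W contains
-- both.  But then W - u is not resolving, so some c ≠ u has the same representation as u with
-- respect to W - u; such a c lies outside W, and (W - u) ∪ {c} is a second basis.
module Submission where

open import Defs
open import Data.Nat using (ℕ; suc; _≤_; _+_; s≤s; z≤n)
open import Data.Nat.Properties
  using (≤-refl; ≤-trans; ≤-reflexive; +-suc; +-comm; +-monoʳ-≤; n≤1+n; <⇒≱; module ≤-Reasoning)
open import Data.Fin using (Fin; _≟_)
open import Data.Fin.Permutation.Components using (transpose)
open import Data.Fin.Subset using (Subset; _∈_; _⊆_; _∪_; _-_; ⁅_⁆; ∣_∣; inside; outside)
open import Data.Fin.Subset.Properties
  using (_∈?_; x∈⁅x⁆; ∣⁅x⁆∣≡1; x∈p∪q⁺; p⊆p∪q; x∈p∧x≢y⇒x∈p-y; x∈p⇒∣p-x∣<∣p∣)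
open import Data.Vec.Base using ([]; _∷_)
open import Data.Product using (_×_; _,_; proj₁; proj₂)
open import Data.Sum using (_⊎_; inj₁; inj₂)
open import Data.Empty using (⊥; ⊥-elim)
open import Relation.Binary.PropositionalEquality
open import Relation.Nullary using (¬_; Dec; yes; no)
open import Relation.Nullary.Decidable using (dec-true; dec-false)

∣p∪q∣≤∣p∣+∣q∣ : ∀ {n} (p q : Subset n) → ∣ p ∪ q ∣ ≤ ∣ p ∣ + ∣ q ∣
∣p∪q∣≤∣p∣+∣q∣ []            []            = ≤-refl
∣p∪q∣≤∣p∣+∣q∣ (outside ∷ p) (outside ∷ q) = ∣p∪q∣≤∣p∣+∣q∣ p q
∣p∪q∣≤∣p∣+∣q∣ (inside  ∷ p) (outside ∷ q) = s≤s (∣p∪q∣≤∣p∣+∣q∣ p q)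
∣p∪q∣≤∣p∣+∣q∣ (outside ∷ p) (inside  ∷ q) =
  ≤-trans (s≤s (∣p∪q∣≤∣p∣+∣q∣ p q)) (≤-reflexive (sym (+-suc ∣ p ∣ ∣ q ∣)))
∣p∪q∣≤∣p∣+∣q∣ (inside  ∷ p) (inside  ∷ q) =
  s≤s (≤-trans (∣p∪q∣≤∣p∣+∣q∣ p q) (+-monoʳ-≤ ∣ p ∣ (n≤1+n ∣ q ∣)))

∣p-x∪⁅y⁆∣≤∣p∣ : ∀ {n} {p : Subset n} {x} (y : Fin n) → x ∈ p → ∣ (p - x) ∪ ⁅ y ⁆ ∣ ≤ ∣ p ∣
∣p-x∪⁅y⁆∣≤∣p∣ {p = p} {x} y x∈p = begin
  ∣ (p - x) ∪ ⁅ y ⁆ ∣     ≤⟨ ∣p∪q∣≤∣p∣+∣q∣ (p - x) ⁅ y ⁆ ⟩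
  ∣ p - x ∣ + ∣ ⁅ y ⁆ ∣   ≡⟨ cong (∣ p - x ∣ +_) (∣⁅x⁆∣≡1 y) ⟩
  ∣ p - x ∣ + 1           ≡⟨ +-comm ∣ p - x ∣ 1 ⟩
  suc ∣ p - x ∣           ≤⟨ x∈p⇒∣p-x∣<∣p∣ x∈p ⟩
  ∣ p ∣                   ∎
  where open ≤-Reasoning

module _ {n} (i j : Fin n) where

  transpose-matchˡ : transpose i j i ≡ j
  transpose-matchˡ rewrite dec-true (i ≟ i) refl = refl

  transpose-matchʳ : transpose i j j ≡ i
  transpose-matchʳ with j ≟ i
  ... | yes j≡i = j≡i
  ... | no _ rewrite dec-true (j ≟ j) refl = refl

  transpose-other : ∀ {k} → k ≢ i → k ≢ j → transpose i j k ≡ k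
  transpose-other {k} k≢i k≢j rewrite dec-false (k ≟ i) k≢i | dec-false (k ≟ j) k≢j = refl

  transpose-involutive : ∀ k → transpose i j (transpose i j k) ≡ k
  transpose-involutive k = by-cases (k ≟ i) (k ≟ j)
    where
    by-cases : Dec (k ≡ i) → Dec (k ≡ j) → transpose i j (transpose i j k) ≡ k
    by-cases (yes refl) _          = trans (cong (transpose i j) transpose-matchˡ) transpose-matchʳ
    by-cases (no _)     (yes refl) = trans (cong (transpose i j) transpose-matchʳ) transpose-matchˡ
    by-cases (no k≢i)   (no k≢j)   =
      trans (cong (transpose i j) (transpose-other k≢i k≢j)) (transpose-other k≢i k≢j)

module _ {n : ℕ} (G : Graph n) where
  open Graph G renaming (sym to adj-sym)

  sameRep-sym : ∀ {W a b} → SameRep G W a b → SameRep G W b a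
  sameRep-sym s w w∈W k = proj₂ (s w w∈W k) , proj₁ (s w w∈W k)

  sameRep-trans : ∀ {W a b c} → SameRep G W a b → SameRep G W b c → SameRep G W a c
  sameRep-trans s t w w∈W k =
    (λ d → proj₁ (t w w∈W k) (proj₁ (s w w∈W k) d)) ,
    (λ d → proj₂ (s w w∈W k) (proj₂ (t w w∈W k) d))

  sameRep-antimono : ∀ {W W′ a b} → W ⊆ W′ → SameRep G W′ a b → SameRep G W a b
  sameRep-antimono W⊆W′ s w w∈W = s w (W⊆W′ w∈W)

  sameRep-∈ : ∀ {W a c} → c ∈ W → SameRep G W a c → a ≡ c
  sameRep-∈ {c = c} c∈W s with proj₂ (s c c∈W 0) ([] , λ _ _ → z≤n)
  ... | [] , _ = refl

  resolving-by-pivot : ∀ {W} u →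
    (∀ {a b} → a ≢ u → b ≢ u → SameRep G W a b → a ≡ b) →
    (∀ {c} → c ≢ u → ¬ SameRep G W u c) →
    Resolving G W
  resolving-by-pivot u away-from-u at-u a b s with a ≟ u | b ≟ u
  ... | yes a≡u | yes b≡u = trans a≡u (sym b≡u)
  ... | yes refl | no b≢u = ⊥-elim (at-u b≢u s)
  ... | no a≢u | yes refl = ⊥-elim (at-u a≢u (sameRep-sym s))
  ... | no a≢u | no b≢u = away-from-u a≢u b≢u s

  IsUniqueBasis : Subset n → Set
  IsUniqueBasis W = MetricBasis G W × (∀ W′ → MetricBasis G W′ → W′ ≡ W)

  exchange-into-unique-basis : ∀ {W u c} → IsUniqueBasis W → u ∈ W →
    Resolving G ((W - u) ∪ ⁅ c ⁆) → c ∈ W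
  exchange-into-unique-basis {W} {u} {c} ((_ , minimal) , unique) u∈W resolving =
    subst (c ∈_) (unique _ (resolving , λ W″ r → ≤-trans (∣p-x∪⁅y⁆∣≤∣p∣ c u∈W) (minimal W″ r)))
      (x∈p∪q⁺ (inj₂ (x∈⁅x⁆ c)))

  module InvolutiveAutomorphism (σ : Fin n → Fin n) (σ-involutive : ∀ x → σ (σ x) ≡ x)
                                (σ-adj : ∀ {x y} → Adj x y → Adj (σ x) (σ y)) where

    walk-map : ∀ {x y k} → Walk G x y k → Walk G (σ x) (σ y) k
    walk-map []      = []
    walk-map (e ∷ w) = σ-adj e ∷ walk-map w

    dist-map : ∀ {x y x′ y′ k} → σ x ≡ x′ → σ y ≡ y′ → Dist G x y k → Dist G x′ y′ k
    dist-map {x} {y} refl refl (w , shortest) =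
      walk-map w ,
      λ j w′ → shortest j (subst₂ (λ a b → Walk G a b j) (σ-involutive x) (σ-involutive y) (walk-map w′))

    resolving-map : ∀ {W W′} → (∀ {w} → w ∈ W → σ w ∈ W′) → Resolving G W → Resolving G W′
    resolving-map {W} {W′} σ[W]⊆W′ resolving a b s = begin
      a         ≡⟨ σ-involutive a ⟨
      σ (σ a)   ≡⟨ cong σ (resolving (σ a) (σ b) same-image) ⟩
      σ (σ b)   ≡⟨ σ-involutive b ⟩
      b         ∎
      where
      open ≡-Reasoning
      same-image : SameRep G W (σ a) (σ b)
      same-image w w∈W k with s (σ w) (σ[W]⊆W′ w∈W) k
      ... | to , from =
        (λ d → dist-map refl (σ-involutive w) (to (dist-map (σ-involutive a) refl d))) ,
        (λ d → dist-map refl (σ-involutive w) (from (dist-map (σ-involutive b) refl d)))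

  twins-sym : ∀ {u v} → Twins G u v → Twins G v u
  twins-sym (u≢v , adj) =
    (λ v≡u → u≢v (sym v≡u)) , λ x x≢v x≢u → proj₂ (adj x x≢u x≢v) , proj₁ (adj x x≢u x≢v)

  module TwinPair {u v} (twins : Twins G u v) where

    u≢v : u ≢ v
    u≢v = proj₁ twins

    σ : Fin n → Fin n
    σ = transpose u v

    σu≡v : σ u ≡ v
    σu≡v = transpose-matchˡ u v

    σv≡u : σ v ≡ u
    σv≡u = transpose-matchʳ u v

    σ-fixes : ∀ {x} → x ≢ u → x ≢ v → σ x ≡ x
    σ-fixes = transpose-other u v

    -- A view, because `with x ≟ u` would also abstract the test that `transpose u v x` branches on.
    data Position (x : Fin n) : Set where
      at-u      : x ≡ u → Position x
      at-v      : x ≡ v → Position x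
      elsewhere : x ≢ u → x ≢ v → Position x

    position : ∀ x → Position x
    position x with x ≟ u | x ≟ v
    ... | yes x≡u | _       = at-u x≡u
    ... | no _    | yes x≡v = at-v x≡v
    ... | no x≢u  | no x≢v  = elsewhere x≢u x≢v

    σ-adj-fixed : ∀ {x y} → y ≢ u → y ≢ v → Adj x y → Adj (σ x) y
    σ-adj-fixed {x} y≢u y≢v e with position x
    ... | at-u refl = subst (λ z → Adj z _) (sym σu≡v) (proj₁ (proj₂ twins _ y≢u y≢v) e)
    ... | at-v refl = subst (λ z → Adj z _) (sym σv≡u) (proj₂ (proj₂ twins _ y≢u y≢v) e)
    ... | elsewhere x≢u x≢v = subst (λ z → Adj z _) (sym (σ-fixes x≢u x≢v)) e

    σ-adj : ∀ {x y} → Adj x y → Adj (σ x) (σ y)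
    σ-adj {x} {y} e with position x | position y
    ... | _         | elsewhere y≢u y≢v = subst (Adj _) (sym (σ-fixes y≢u y≢v)) (σ-adj-fixed y≢u y≢v e)
    ... | at-u refl | at-u refl = ⊥-elim (irrefl e)
    ... | at-v refl | at-v refl = ⊥-elim (irrefl e)
    ... | at-u refl | at-v refl = subst₂ Adj (sym σu≡v) (sym σv≡u) (adj-sym e)
    ... | at-v refl | at-u refl = subst₂ Adj (sym σv≡u) (sym σu≡v) (adj-sym e)
    ... | elsewhere x≢u x≢v | at-u refl =
      subst (λ z → Adj z _) (sym (σ-fixes x≢u x≢v)) (adj-sym (σ-adj-fixed x≢u x≢v (adj-sym e)))
    ... | elsewhere x≢u x≢v | at-v refl =
      subst (λ z → Adj z _) (sym (σ-fixes x≢u x≢v)) (adj-sym (σ-adj-fixed x≢u x≢v (adj-sym e)))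

    open InvolutiveAutomorphism σ (transpose-involutive u v) σ-adj

    twin-∈-resolving : ∀ {W} → Resolving G W → u ∈ W ⊎ v ∈ W
    twin-∈-resolving {W} resolving with u ∈? W | v ∈? W
    ... | yes u∈W | _ = inj₁ u∈W
    ... | no _ | yes v∈W = inj₂ v∈W
    ... | no u∉W | no v∉W = ⊥-elim (u≢v (resolving u v same))
      where
      same : SameRep G W u v
      same w w∈W k = dist-map σu≡v (σ-fixes w≢u w≢v) , dist-map σv≡u (σ-fixes w≢u w≢v)
        where
        w≢u : w ≢ u
        w≢u refl = u∉W w∈W
        w≢v : w ≢ v
        w≢v refl = v∉W w∈W

    twin-∈-unique-basis : ∀ {W} → IsUniqueBasis W → u ∈ W → v ∈ W
    twin-∈-unique-basis {W} basis u∈W with v ∈? W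
    ... | yes v∈W = v∈W
    ... | no v∉W = exchange-into-unique-basis basis u∈W (resolving-map σ[W]⊆W′ (proj₁ (proj₁ basis)))
      where
      σ[W]⊆W′ : ∀ {w} → w ∈ W → σ w ∈ (W - u) ∪ ⁅ v ⁆
      σ[W]⊆W′ {w} w∈W with position w
      ... | at-u refl = subst (_∈ (W - u) ∪ ⁅ v ⁆) (sym σu≡v) (x∈p∪q⁺ (inj₂ (x∈⁅x⁆ v)))
      ... | at-v refl = ⊥-elim (v∉W w∈W)
      ... | elsewhere w≢u w≢v =
        subst (_∈ _) (sym (σ-fixes w≢u w≢v)) (p⊆p∪q ⁅ v ⁆ (x∈p∧x≢y⇒x∈p-y w∈W w≢u))

    module BothInBasis {W} (basis : IsUniqueBasis W) (u∈W : u ∈ W) (v∈W : v ∈ W) where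

      v∈W-u : v ∈ W - u
      v∈W-u = x∈p∧x≢y⇒x∈p-y v∈W (λ v≡u → u≢v (sym v≡u))

      -- The distances to u are those to v, which W - u still sees.
      sameRep-restore : ∀ {a b} → a ≢ u → a ≢ v → b ≢ u → b ≢ v →
        SameRep G (W - u) a b → SameRep G W a b
      sameRep-restore a≢u a≢v b≢u b≢v s w w∈W k with w ≟ u
      ... | yes refl =
        (λ d → dist-map (σ-fixes b≢u b≢v) σv≡u (proj₁ (s v v∈W-u k) (dist-map (σ-fixes a≢u a≢v) σu≡v d))) ,
        (λ d → dist-map (σ-fixes a≢u a≢v) σv≡u (proj₂ (s v v∈W-u k) (dist-map (σ-fixes b≢u b≢v) σu≡v d)))
      ... | no w≢u = s w (x∈p∧x≢y⇒x∈p-y w∈W w≢u) k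

      resolved-away-from-u : ∀ {a b} → a ≢ u → b ≢ u → SameRep G (W - u) a b → a ≡ b
      resolved-away-from-u {a} {b} a≢u b≢u s with a ≟ v | b ≟ v
      ... | yes refl | _ = sym (sameRep-∈ v∈W-u (sameRep-sym s))
      ... | no _ | yes refl = sameRep-∈ v∈W-u s
      ... | no a≢v | no b≢v = proj₁ (proj₁ basis) a b (sameRep-restore a≢u a≢v b≢u b≢v s)

      -- A c with the representation of u would make (W - u) ∪ {c} a basis with c ∉ W.
      resolved-at-u : ∀ {c} → c ≢ u → ¬ SameRep G (W - u) u c
      resolved-at-u {c} c≢u s = c≢u (sym (sameRep-∈ (x∈p∧x≢y⇒x∈p-y c∈W c≢u) s))
        where
        W′ : Subset n
        W′ = (W - u) ∪ ⁅ c ⁆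

        W-u⊆W′ : W - u ⊆ W′
        W-u⊆W′ = p⊆p∪q ⁅ c ⁆

        c-resolved-at-u : ∀ {d} → d ≢ u → ¬ SameRep G W′ u d
        c-resolved-at-u {d} d≢u s′
          with resolved-away-from-u c≢u d≢u (sameRep-trans (sameRep-sym s) (sameRep-antimono W-u⊆W′ s′))
        ... | refl = c≢u (sym (sameRep-∈ (x∈p∪q⁺ (inj₂ (x∈⁅x⁆ c))) s′))

        c∈W : c ∈ W
        c∈W = exchange-into-unique-basis basis u∈W
          (resolving-by-pivot u
            (λ a≢u b≢u s′ → resolved-away-from-u a≢u b≢u (sameRep-antimono W-u⊆W′ s′))
            c-resolved-at-u)

      absurd : ⊥
      absurd = <⇒≱ (x∈p⇒∣p-x∣<∣p∣ u∈W)
        (proj₂ (proj₁ basis) (W - u) (resolving-by-pivot u resolved-away-from-u resolved-at-u))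

lemma2 : ∀ {n} (G : Graph n) → Connected G → UniquelyDimensional G →
    ∀ (u v : Fin n) → ¬ Twins G u v
lemma2 G _ (W , basis) u v twins
  with TwinPair.twin-∈-resolving G twins (proj₁ (proj₁ basis))
... | inj₁ u∈W = TwinPair.BothInBasis.absurd G twins basis u∈W
                   (TwinPair.twin-∈-unique-basis G twins basis u∈W)
... | inj₂ v∈W = TwinPair.BothInBasis.absurd G (twins-sym G twins) basis v∈W
                   (TwinPair.twin-∈-unique-basis G (twins-sym G twins) basis v∈W)
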